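{- Fix $n\geq1$ and $1\le i<j\le2^n$. Suppose $\mathcal A^n_i$ and $\mathcal A^n_j$ have the same critical height $m$. Then $\mathcal A^n_i$ and $\mathcal A^n_j$ are distinguished by some $r<m$. Moreover: (a) if $i\le2^{n-1}$ and $2^{n-1}<j$, then $\mathcal A^n_i$ and $\mathcal A^n_j$ have distinguishing value $0$; (b) if $\mathcal A^n_i$ and $\mathcal A^n_j$ have distinguishing value $r$, then $\mathcal A^{n+1}_i$ and $\mathcal A^{n+1}_j$ have distinguishing value $r$, and $\mathcal A^{n+1}_{2^n+i}$ and $\mathcal A^{n+1}_{2^n+j}$ have distinguishing value $r+1$.
   Context: Models considered are finite Kripke models $(W,R,V)$ with $R$ transitive and irreflexive, whose frame is a tree, equipped with a partial successor function $S$ sending some points to one of their daughters. For a rooted such model $\mathcal M$ with root $w_0$, its critical branch is the maximal sequence $w_0,w_1,\dots,w_m$ with $w_{t+1}=S(w_t)$, and $m$ is its critical height; $S[\mathcal M]$ is the submodel generated by $S(w_0)$. For rooted models with successors $\mathcal M,\mathcal N$ with roots $w,v$, a number $r$ distinguishes them (and is their distinguishing value) if $S^r(w)$ and $S^r(v)$ are defined and differ on the truth of some propositional variable, while for every $t<r$, $S^t(w)$ and $S^t(v)$ agree on the truth of all propositional variables. Adding a fresh root to a model $Z$ means adding a new irreflexive point that $R$-sees every point of $Z$ and satisfies no variable. For $n\geq1$ and $1\le i\le2^n$, models $\mathcal A^n_i,\mathcal B^n_i$ with roots $a^n_i,b^n_i$ are defined by recursion: for every $n\geq0$, (i) if $i\le2^n$: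 when $n=0$, $\mathcal A^1_1$ is a single point where exactly $p_1$ is true and $\mathcal B^1_1$ a single point where no variable is true (empty $S$); when $n\ge1$, $\mathcal A^{n+1}_i$ (resp. $\mathcal B^{n+1}_i$) is a copy of $\mathcal A^n_i$ (resp. $\mathcal B^n_i$), same $S$, with $p_{n+1}$ additionally true at the root. (ii) if $i=2^n+j$, $1\le j\le2^n$: $\mathcal B^{n+1}_{2^n+j}$ is obtained by adding a fresh root $b$ to $\bigsqcup_{k=2}^{2^n}S[\mathcal A^{n+1}_k]\sqcup\mathcal B^{n+1}_j$, with successor function $S_{\mathcal B^{n+1}_j}\cup\{(b,b^{n+1}_j)\}$; $\mathcal A^{n+1}_{2^n+j}$ is obtained by adding a fresh root $a$ to $\bigsqcup_{k=2}^{2^n}S[\mathcal A^{n+1}_k]\sqcup\mathcal B^{n+1}_j\sqcup\mathcal A^{n+1}_j$, with successor function $S_{\mathcal A^{n+1}_j}\cup\{(a,a^{n+1}_j)\}$ (for $n=0$ the union over $k$ is empty). -}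

module Defs where

open import Data.Nat using (ℕ; zero; suc; _+_; _∸_; _^_; _≤?_; _≡ᵇ_; _<_)
open import Data.Bool using (Bool; true; false; _∨_)
open import Data.Maybe using (Maybe; just; nothing)
open import Data.List using (List; []; _∷_; _++_; map; upTo)
open import Data.Product using (_×_; _,_; proj₁; proj₂; ∃)
open import Relation.Nullary using (yes; no; ¬_)
open import Relation.Binary.PropositionalEquality using (_≡_)

-- A finite rooted Kripke model with successor whose frame is a tree,
-- R being the (transitive, irreflexive) strict-descendant relation.
-- A node carries its valuation (variable k ↦ truth of p_k), an optional
-- S-daughter (the value of the successor function S at this node),
-- and the list of its remaining daughters.
data Model : Set where
  node : (val : ℕ → Bool) → (sdaughter : Maybe Model) → (others : List Model) → Model

val : Model → ℕ → Bool
val (node v _ _) = v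

-- S(root) as a rooted submodel: S[M], the submodel generated by S(w0)
S[_] : Model → Maybe Model
S[ node _ s _ ] = s

Siter : ℕ → Model → Maybe Model
Siter zero    M = just M
Siter (suc r) (node _ nothing  _) = nothing
Siter (suc r) (node _ (just s) _) = Siter r s

criticalHeight : Model → ℕ
criticalHeight (node _ nothing  _) = 0
criticalHeight (node _ (just s) _) = suc (criticalHeight s)

Distinguishes : ℕ → Model → Model → Set
Distinguishes r M N =
  (∃ λ u → ∃ λ u' → Siter r M ≡ just u × Siter r N ≡ just u'
      × (∃ λ k → ¬ (val u k ≡ val u' k)))
  × (∀ t → t < r → ∀ u u' → Siter t M ≡ just u → Siter t N ≡ just u'
      → ∀ k → val u k ≡ val u' k)

catMaybes : {A : Set} → List (Maybe A) → List A
catMaybes [] = []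
catMaybes (nothing ∷ xs) = catMaybes xs
catMaybes (just x ∷ xs) = x ∷ catMaybes xs

addVarRoot : ℕ → Model → Model
addVarRoot k (node v s os) = node (λ x → (x ≡ᵇ k) ∨ v x) s os

noVar : ℕ → Bool
noVar _ = false

-- pre n i = (A^{n+1}_i , B^{n+1}_i) for 1 ≤ i ≤ 2^n  (case (i))
-- level n i = (A^{n+1}_i , B^{n+1}_i) for 1 ≤ i ≤ 2^{n+1}
pre   : ℕ → ℕ → Model × Model
level : ℕ → ℕ → Model × Model

pre zero i = node (λ x → x ≡ᵇ 1) nothing [] , node noVar nothing []
pre (suc n) i = addVarRoot (suc (suc n)) (proj₁ (level n i))
              , addVarRoot (suc (suc n)) (proj₂ (level n i))

level n i with i ≤? 2 ^ n
... | yes _ = pre n i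
... | no  _ =
  let j   = i ∸ 2 ^ n
      Aj  = proj₁ (pre n j)
      Bj  = proj₂ (pre n j)
      -- S[A^{n+1}_k] for k = 2 .. 2^n
      SAs = catMaybes (map (λ m → S[ proj₁ (pre n (suc (suc m))) ]) (upTo (2 ^ n ∸ 1)))
  in node noVar (just Aj) (SAs ++ (Bj ∷ []))
   , node noVar (just Bj) SAs

-- A^n_i and B^n_i (meaningful for n ≥ 1, 1 ≤ i ≤ 2^n)
𝒜 : ℕ → ℕ → Model
𝒜 n i = proj₁ (level (n ∸ 1) i)

ℬ : ℕ → ℕ → Model
ℬ n i = proj₂ (level (n ∸ 1) i)

-- Write A m i = 𝒜^{m+1}_i and A⁰ m i for the "case (i)" model built by
-- `pre`.  For i ≤ 2^m the model A m i is A⁰ m i, which for m ≥ 1 is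
-- A (m-1) i with p_{m+1} added at the root; for i > 2^m it is a fresh
-- root whose S-daughter is A⁰ m (i - 2^m).  The proof rests on two
-- facts about distinguishing values, valid for arbitrary models:
--   * adding a variable p_k at both roots keeps the distinguishing
--     value, provided p_k was false at both roots;
--   * putting fresh roots above two models (as S-daughters) raises the
--     distinguishing value by one.
-- Together with the observations that p_k (k > m+1) is false at the root
-- of A m i, while p_{m+1} is true at the root of A⁰ m i and false at a
-- fresh root, these give (a) and (b) directly.  The first claim, that
-- models of equal critical height are distinguished below that height,
-- is the property `HeightSeparated`; it is preserved by both operations
-- above and follows by induction on m, splitting on the halves of i, j.

module Submission where

open import Defs
open import Data.Nat using (ℕ; zero; suc; _+_; _∸_; _^_; _≤_; _<_; _≤?_; _≡ᵇ_; z≤n; s≤s)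
open import Data.Nat.Properties
  using (≡ᵇ⇒≡; ≤-refl; ≤-trans; ≤-reflexive; <⇒≤; <⇒≱; ≰⇒>; m<m+n; m+n∸m≡n; n≤1+n;
         suc-injective; m<n⇒0<n∸m; ∸-monoˡ-<; ∸-monoˡ-≤; +-identityʳ)
open import Data.Bool using (true; false; _∨_; T)
open import Data.Maybe using (just; nothing)
open import Data.List using (List)
open import Data.Product using (_×_; ∃; _,_; proj₁)
open import Data.Empty using (⊥-elim)
open import Relation.Nullary using (¬_; yes; no)
open import Relation.Binary.PropositionalEquality
  using (_≡_; _≢_; refl; sym; trans; cong; cong₂; subst; subst₂)

freshRoot : Model → List Model → Model
freshRoot M os = node noVar (just M) os

-- Distinguishing is preserved when p_k is made true at both roots,
-- as long as p_k was false there: agreement at the roots survives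
-- trivially, and a disagreement cannot be on p_k itself.
addVarRoot-distinguishes : ∀ k r M N → val M k ≡ false → val N k ≡ false →
  Distinguishes r M N → Distinguishes r (addVarRoot k M) (addVarRoot k N)
addVarRoot-distinguishes k zero (node v _ _) (node w _ _) vk wk
  ((_ , _ , refl , refl , x , v≢w) , _) =
  (_ , _ , refl , refl , x , keepsDifference) , λ _ ()
  where
  -- if x were k, both sides would be false before adding p_k
  keepsDifference : (x ≡ᵇ k) ∨ v x ≢ (x ≡ᵇ k) ∨ w x
  keepsDifference with x ≡ᵇ k in x≡ᵇk
  ... | false = v≢w
  ... | true with ≡ᵇ⇒≡ x k (subst T (sym x≡ᵇk) _)
  ... | refl = λ _ → v≢w (trans vk (sym wk))
addVarRoot-distinguishes k (suc r) (node _ nothing _) _ _ _ ((_ , _ , () , _) , _)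
addVarRoot-distinguishes k (suc r) (node _ (just _) _) (node _ nothing _) _ _
  ((_ , _ , _ , () , _) , _)
addVarRoot-distinguishes k (suc r) (node v (just M) os) (node w (just N) os') _ _
  (differ , agreeBelow) = differ , agreeBelow'
  where
  agreeBelow' : ∀ t → t < suc r → ∀ u u' →
    Siter t (addVarRoot k (node v (just M) os)) ≡ just u →
    Siter t (addVarRoot k (node w (just N) os')) ≡ just u' → ∀ x → val u x ≡ val u' x
  agreeBelow' zero _ _ _ refl refl x = cong ((x ≡ᵇ k) ∨_) (agreeBelow 0 (s≤s z≤n) _ _ refl refl x)
  agreeBelow' (suc t) = agreeBelow (suc t)

-- Fresh roots agree everywhere, so they shift the distinguishing value.
freshRoot-distinguishes : ∀ r M N os os' →
  Distinguishes r M N → Distinguishes (suc r) (freshRoot M os) (freshRoot N os')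
freshRoot-distinguishes r M N os os' (differ , agreeBelow) = differ , agreeBelow'
  where
  agreeBelow' : ∀ t → t < suc r → ∀ u u' → Siter t (freshRoot M os) ≡ just u →
    Siter t (freshRoot N os') ≡ just u' → ∀ x → val u x ≡ val u' x
  agreeBelow' zero _ _ _ refl refl _ = refl
  agreeBelow' (suc t) (s≤s t<r) = agreeBelow t t<r

rootDifference-distinguishes : ∀ M N k → val M k ≢ val N k → Distinguishes 0 M N
rootDifference-distinguishes M N k Mk≢Nk = (M , N , refl , refl , k , Mk≢Nk) , λ _ ()

true≢false : true ≢ false
true≢false ()

addVarRoot-criticalHeight : ∀ k M → criticalHeight (addVarRoot k M) ≡ criticalHeight M
addVarRoot-criticalHeight k (node _ nothing _) = refl
addVarRoot-criticalHeight k (node _ (just _) _) = refl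

HeightSeparated : Model → Model → Set
HeightSeparated M N = criticalHeight M ≡ criticalHeight N →
  ∃ λ r → r < criticalHeight M × Distinguishes r M N

addVarRoot-heightSeparated : ∀ k M N → val M k ≡ false → val N k ≡ false →
  HeightSeparated M N → HeightSeparated (addVarRoot k M) (addVarRoot k N)
addVarRoot-heightSeparated k M N Mk Nk sep sameHeight
  with sep (trans (sym (addVarRoot-criticalHeight k M))
                  (trans sameHeight (addVarRoot-criticalHeight k N)))
... | r , r<h , d =
  r , subst (r <_) (sym (addVarRoot-criticalHeight k M)) r<h ,
  addVarRoot-distinguishes k r M N Mk Nk d

freshRoot-heightSeparated : ∀ M N os os' →
  HeightSeparated M N → HeightSeparated (freshRoot M os) (freshRoot N os')
freshRoot-heightSeparated M N os os' sep sameHeight with sep (suc-injective sameHeight)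
... | r , r<h , d = suc r , s≤s r<h , freshRoot-distinguishes r M N os os' d

distinguishes0-heightSeparated : ∀ M N → 0 < criticalHeight N →
  Distinguishes 0 M N → HeightSeparated M N
distinguishes0-heightSeparated M N 0<h d sameHeight =
  0 , subst (0 <_) (sym sameHeight) 0<h , d

-- A m i = 𝒜^{m+1}_i, and A⁰ m i its "case (i)" form used for i ≤ 2^m.
A : ℕ → ℕ → Model
A m i = proj₁ (level m i)

A⁰ : ℕ → ℕ → Model
A⁰ m i = proj₁ (pre m i)

A-low : ∀ m i → i ≤ 2 ^ m → A m i ≡ A⁰ m i
A-low m i i≤ with i ≤? 2 ^ m
... | yes _ = refl
... | no i≰ = ⊥-elim (i≰ i≤)

A-high : ∀ m i → ¬ i ≤ 2 ^ m → ∃ λ os → A m i ≡ freshRoot (A⁰ m (i ∸ 2 ^ m)) os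
A-high m i i≰ with i ≤? 2 ^ m
... | yes i≤ = ⊥-elim (i≰ i≤)
... | no _ = _ , refl

A-upperHalf : ∀ m i → 1 ≤ i → ∃ λ os → A m (2 ^ m + i) ≡ freshRoot (A⁰ m i) os
A-upperHalf m i 1≤i with A-high m (2 ^ m + i) (<⇒≱ (m<m+n (2 ^ m) 1≤i))
... | os , eq = os , trans eq (cong (λ l → freshRoot (A⁰ m l) os) (m+n∸m≡n (2 ^ m) i))

≡ᵇ-false : ∀ k l → l < k → (k ≡ᵇ l) ≡ false
≡ᵇ-false (suc k) zero _ = refl
≡ᵇ-false (suc k) (suc l) (s≤s l<k) = ≡ᵇ-false k l l<k

≡ᵇ-refl : ∀ k → (k ≡ᵇ k) ≡ true
≡ᵇ-refl zero = refl
≡ᵇ-refl (suc k) = ≡ᵇ-refl k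

val-addVarRoot : ∀ k M x → val (addVarRoot k M) x ≡ (x ≡ᵇ k) ∨ val M x
val-addVarRoot k (node _ _ _) x = refl

mutual
  A-rootFalse : ∀ m i k → suc m < k → val (A m i) k ≡ false
  A-rootFalse m i k m+1<k with i ≤? 2 ^ m
  ... | yes _ = A⁰-rootFalse m i k m+1<k
  ... | no _ = refl

  A⁰-rootFalse : ∀ m i k → suc m < k → val (A⁰ m i) k ≡ false
  A⁰-rootFalse zero i (suc zero) (s≤s ())
  A⁰-rootFalse zero i (suc (suc k)) _ = refl
  A⁰-rootFalse (suc m) i k m+2<k =
    trans (val-addVarRoot (suc (suc m)) (A m i) k)
          (cong₂ _∨_ (≡ᵇ-false k (suc (suc m)) m+2<k)
                     (A-rootFalse m i k (≤-trans (n≤1+n (suc (suc m))) m+2<k)))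

A⁰-rootTrue : ∀ m i → val (A⁰ m i) (suc m) ≡ true
A⁰-rootTrue zero i = refl
A⁰-rootTrue (suc m) i =
  trans (val-addVarRoot (suc (suc m)) (A m i) (suc (suc m)))
        (cong (_∨ val (A m i) (suc (suc m))) (≡ᵇ-refl m))

-- A⁰ m i satisfies p_{m+1} at its root, a fresh root does not.
A⁰-freshRoot-distinguishes : ∀ m i M os → Distinguishes 0 (A⁰ m i) (freshRoot M os)
A⁰-freshRoot-distinguishes m i M os = rootDifference-distinguishes _ _ (suc m)
  (λ eq → true≢false (trans (sym (A⁰-rootTrue m i)) eq))

-- Part (a): across the two halves the roots disagree on p_{m+1}.
A-acrossHalves : ∀ m i j → i ≤ 2 ^ m → 2 ^ m < j → Distinguishes 0 (A m i) (A m j)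
A-acrossHalves m i j i≤ 2^m<j with i ≤? 2 ^ m | j ≤? 2 ^ m
... | no i≰ | _     = ⊥-elim (i≰ i≤)
... | yes _ | yes j≤ = ⊥-elim (<⇒≱ 2^m<j j≤)
... | yes _ | no _  = A⁰-freshRoot-distinguishes m i _ _

mutual
  A⁰-heightSeparated : ∀ m i j → 1 ≤ i → i < j → j ≤ 2 ^ m →
    HeightSeparated (A⁰ m i) (A⁰ m j)
  A⁰-heightSeparated zero (suc zero) (suc zero) _ (s≤s ()) _
  A⁰-heightSeparated zero (suc zero) (suc (suc j)) _ _ (s≤s ())
  A⁰-heightSeparated (suc m) i j 1≤i i<j j≤ =
    addVarRoot-heightSeparated (suc (suc m)) (A m i) (A m j)
      (A-rootFalse m i _ ≤-refl) (A-rootFalse m j _ ≤-refl)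
      (A-heightSeparated m i j 1≤i i<j j≤)

  A-heightSeparated : ∀ m i j → 1 ≤ i → i < j → j ≤ 2 ^ suc m →
    HeightSeparated (A m i) (A m j)
  A-heightSeparated m i j 1≤i i<j j≤ with i ≤? 2 ^ m | j ≤? 2 ^ m
  ... | yes _  | yes j≤' = A⁰-heightSeparated m i j 1≤i i<j j≤'
  ... | yes _  | no _    =
    distinguishes0-heightSeparated _ _ (s≤s z≤n) (A⁰-freshRoot-distinguishes m i _ _)
  ... | no i≰  | yes j≤' = ⊥-elim (i≰ (≤-trans (<⇒≤ i<j) j≤'))
  ... | no i≰  | no _    =
    freshRoot-heightSeparated _ _ _ _
      (A⁰-heightSeparated m (i ∸ K) (j ∸ K) (m<n⇒0<n∸m (≰⇒> i≰))
        (∸-monoˡ-< i<j (<⇒≤ (≰⇒> i≰))) j∸K≤K)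
    where
    K = 2 ^ m
    -- 2 ^ suc m unfolds to K + (K + 0)
    j∸K≤K : j ∸ K ≤ K
    j∸K≤K = ≤-trans (∸-monoˡ-≤ K j≤) (≤-reflexive (trans (m+n∸m≡n K (K + 0)) (+-identityʳ K)))

-- Part (b): passing from level m to level m+1, the lower copies gain
-- p_{m+2} at the root and the upper copies get fresh roots above them.
A-nextLevel-distinguishes : ∀ m r i j → 1 ≤ i → i < j → j ≤ 2 ^ suc m →
  Distinguishes r (A m i) (A m j) →
  Distinguishes r (A (suc m) i) (A (suc m) j)
  × Distinguishes (suc r) (A (suc m) (2 ^ suc m + i)) (A (suc m) (2 ^ suc m + j))
A-nextLevel-distinguishes m r i j 1≤i i<j j≤ d
  with A-upperHalf (suc m) i 1≤i | A-upperHalf (suc m) j (≤-trans 1≤i (<⇒≤ i<j))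
... | os , upper-i | os' , upper-j =
  subst₂ (Distinguishes r) (sym (A-low (suc m) i (≤-trans (<⇒≤ i<j) j≤)))
                           (sym (A-low (suc m) j j≤)) lower ,
  subst₂ (Distinguishes (suc r)) (sym upper-i) (sym upper-j)
    (freshRoot-distinguishes r _ _ os os' lower)
  where
  lower : Distinguishes r (A⁰ (suc m) i) (A⁰ (suc m) j)
  lower = addVarRoot-distinguishes (suc (suc m)) r (A m i) (A m j)
            (A-rootFalse m i _ ≤-refl) (A-rootFalse m j _ ≤-refl) d

lemma7p10 : (n i j : ℕ) → 1 ≤ n → 1 ≤ i → i < j → j ≤ 2 ^ n →
    ((criticalHeight (𝒜 n i) ≡ criticalHeight (𝒜 n j) →
        ∃ λ r → r < criticalHeight (𝒜 n i) × Distinguishes r (𝒜 n i) (𝒜 n j))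
    × (i ≤ 2 ^ (n ∸ 1) → 2 ^ (n ∸ 1) < j → Distinguishes 0 (𝒜 n i) (𝒜 n j))
    × ((r : ℕ) → Distinguishes r (𝒜 n i) (𝒜 n j) →
        Distinguishes r (𝒜 (suc n) i) (𝒜 (suc n) j)
        × Distinguishes (suc r) (𝒜 (suc n) (2 ^ n + i)) (𝒜 (suc n) (2 ^ n + j))))
lemma7p10 (suc m) i j _ 1≤i i<j j≤ =
  A-heightSeparated m i j 1≤i i<j j≤ ,
  A-acrossHalves m i j ,
  λ r → A-nextLevel-distinguishes m r i j 1≤i i<j j≤
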